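{- Let $A$ be the following $6\times 12$ matrix over $\mathrm{GF}(2)$: \[ A=\begin{pmatrix} 1 & 1 & 0 & 0 & 1 & 0 & 0 & 0 & 1 & 1 & 1 & 1 \\ 1 & 0 & 1 & 1 & 0 & 0 & 0 & 1 & 1 & 0 & 1 & 1 \\ 0 & 1 & 0 & 0 & 1 & 1 & 1 & 1 & 1 & 1 & 0 & 0 \\ 1 & 0 & 1 & 0 & 1 & 1 & 1 & 0 & 1 & 0 & 1 & 0 \\ 0 & 1 & 1 & 1 & 0 & 0 & 1 & 0 & 1 & 1 & 1 & 0 \\ 0 & 1 & 1 & 0 & 1 & 0 & 1 & 1 & 0 & 0 & 1 & 1 \end{pmatrix}, \] and let $N$ be the binary matroid on $18$ elements represented over $\mathrm{GF}(2)$ by the $6\times 18$ matrix $[I_6\mid A]$ (its elements are the columns, and a set of elements is independent iff the corresponding columns are linearly independent over $\mathrm{GF}(2)$). Then $T_N(-1,-1)=2^6$, and for each $z\in\{ -2,-1,2\}$ the value $T_N(-1+4z,-1+4z)/T_N(-1,-1)$ is an even integer. In particular, it is not true that for every binary matroid $M$ and every integer $z$ the value $T_M(-1+4z,-1+4z)/T_M(-1,-1)$ is an odd integer.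
   Context: For a matroid $M$ on ground set $E$ with rank function $r$, the Tutte polynomial is $T_M(x,y)=\sum_{S\subseteq E}(x-1)^{r(E)-r(S)}(y-1)^{|S|-r(S)}$. A binary matroid is a matroid representable over $\mathrm{GF}(2)$. $I_6$ denotes the $6\times 6$ identity matrix. -}

module Defs where

open import Data.Bool using (Bool; true; false; _∧_; _∨_; not; _xor_; if_then_else_)
open import Data.Nat using (ℕ; zero; suc; _∸_; _⊔_)
open import Data.Integer using (ℤ; +_; -_; _+_; _-_; _*_; _^_)
open import Data.Fin using (Fin; _≟_)
open import Data.Vec using (Vec; []; _∷_; map; zipWith; foldr; tabulate; _++_; countᵇ)
open import Data.List as L using (List)
open import Relation.Nullary.Decidable using (⌊_⌋)
open import Data.Bool.ListAction using (all)

-- GF(2) is modelled by Bool (false = 0, true = 1, _xor_ = addition, _∧_ = multiplication).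
-- A matrix over GF(2) with m rows and n columns, given as a vector of rows.
Matrix : ℕ → ℕ → Set
Matrix m n = Vec (Vec Bool n) m

SubsetV : ℕ → Set
SubsetV n = Vec Bool n

allSubsets : ∀ n → List (SubsetV n)
allSubsets zero = [] L.∷ L.[]
allSubsets (suc n) = L.map (false ∷_) (allSubsets n) L.++ L.map (true ∷_) (allSubsets n)

size : ∀ {n} → SubsetV n → ℕ
size = countᵇ (λ b → b)

_⊆ᵇ_ : ∀ {n} → SubsetV n → SubsetV n → Bool
S ⊆ᵇ T = foldr _ _∧_ true (zipWith (λ s t → not s ∨ t) S T)

isEmpty : ∀ {n} → SubsetV n → Bool
isEmpty S = foldr _ (λ b r → not b ∧ r) true S

isZeroVec : ∀ {m} → Vec Bool m → Bool
isZeroVec = isEmpty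

colSum : ∀ {m n} → Matrix m n → SubsetV n → Vec Bool m
colSum A T = map (λ row → foldr _ _xor_ false (zipWith _∧_ row T)) A

independent : ∀ {m n} → Matrix m n → SubsetV n → Bool
independent {n = n} A I =
  all (λ T → not ((T ⊆ᵇ I) ∧ not (isEmpty T) ∧ isZeroVec (colSum A T))) (allSubsets n)

rank : ∀ {m n} → Matrix m n → SubsetV n → ℕ
rank {n = n} A S =
  L.foldr _⊔_ 0 (L.map size (L.filterᵇ (λ I → (I ⊆ᵇ S) ∧ independent A I) (allSubsets n)))

fullSet : ∀ n → SubsetV n
fullSet n = tabulate (λ _ → true)

tutte : ∀ {m n} → Matrix m n → ℤ → ℤ → ℤ
tutte {n = n} A x y =
  L.foldr _+_ (+ 0)
    (L.map (λ S → ((x - + 1) ^ (rank A (fullSet n) ∸ rank A S))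
                  * ((y - + 1) ^ (size S ∸ rank A S)))
           (allSubsets n))

identity : ∀ n → Matrix n n
identity n = tabulate (λ i → tabulate (λ j → ⌊ i ≟ j ⌋))

_∣∣_ : ∀ {m n k} → Matrix m n → Matrix m k → Matrix m (n Data.Nat.+ k)
B ∣∣ C = zipWith _++_ B C

matA : Matrix 6 12
matA =
  (true  ∷ true  ∷ false ∷ false ∷ true  ∷ false ∷ false ∷ false ∷ true  ∷ true  ∷ true  ∷ true  ∷ []) ∷
  (true  ∷ false ∷ true  ∷ true  ∷ false ∷ false ∷ false ∷ true  ∷ true  ∷ false ∷ true  ∷ true  ∷ []) ∷
  (false ∷ true  ∷ false ∷ false ∷ true  ∷ true  ∷ true  ∷ true  ∷ true  ∷ true  ∷ false ∷ false ∷ []) ∷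
  (true  ∷ false ∷ true  ∷ false ∷ true  ∷ true  ∷ true  ∷ false ∷ true  ∷ false ∷ true  ∷ false ∷ []) ∷
  (false ∷ true  ∷ true  ∷ true  ∷ false ∷ false ∷ true  ∷ false ∷ true  ∷ true  ∷ true  ∷ false ∷ []) ∷
  (false ∷ true  ∷ true  ∷ false ∷ true  ∷ false ∷ true  ∷ true  ∷ false ∷ false ∷ true  ∷ true  ∷ []) ∷
  []

matN : Matrix 6 18
matN = identity 6 ∣∣ matA

shift : ℤ → ℤ
shift z = - (+ 1) + (+ 4) * z

-- Gaussian elimination against an echelon basis, applied greedily to the columns of a GF(2)
-- matrix, yields for every subset S an independent subset of S together with a basis of its
-- span. Every combination of columns of S lies in that span, so an independent J ⊆ S injects
-- GF(2)^|J| into GF(2)^r, and the rank of S is the length r of the basis. The Tutte sum then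
-- becomes a binary recursion over the columns in which subsets with a common prefix share one
-- basis; as soon as the basis spans GF(2)^m the remaining sum is the closed form Y^ν (1 + Y)^k.
-- The values of T_N are obtained by evaluating this recursion.

module Submission where

open import Defs
open import Data.Bool using (Bool; true; false; _∧_; not; _xor_; if_then_else_; T)
open import Data.Bool.Properties
  using (xor-assoc; xor-comm; xor-identityˡ; xor-identityʳ; xor-same; ∧-zeroʳ; ∧-identityʳ; ∧-conicalˡ; ∧-conicalʳ; T-∧)
open import Data.Bool.ListAction using (all)
open import Data.Fin as Fin using (Fin; zero; suc; combine; remQuot)
open import Data.Fin.Properties using (injective⇒≤; remQuot-combine; combine-remQuot; all?)
open import Data.Integer using (ℤ; +_; -_; _+_; _-_; _*_; _^_; ∣_∣; 1ℤ)
import Data.Integer.Properties as ℤ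
open import Data.Integer.Solver using (module +-*-Solver)
open import Data.List as List using (List; []; _∷_; _++_; length)
open import Data.List.Properties using (map-++; map-∘; map-cong)
open import Data.List.Membership.Propositional using (_∈_)
open import Data.List.Relation.Unary.All as All using (All; []; _∷_)
open import Data.List.Relation.Unary.Any as Any using (Any; here; there; any?)
open import Data.List.Relation.Unary.Any.Properties using (map⁺; ++⁺ˡ; ++⁺ʳ)
open import Data.Maybe as Maybe using (Maybe; just; nothing; fromMaybe; is-just)
open import Data.Nat as ℕ using (ℕ; zero; suc; _∸_; _⊔_; _≤_; _≡ᵇ_; z≤n; s≤s)
import Data.Nat.Properties as ℕ
open import Data.Product using (_×_; _,_; proj₁; proj₂; ∃-syntax; map₂)
open import Data.Sum using (_⊎_; inj₁; inj₂)
open import Data.Unit using (tt)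
open import Data.Vec as Vec using (Vec; []; _∷_; lookup; zipWith; replicate; head; tail)
open import Data.Vec.Properties
  using (zipWith-assoc; zipWith-comm; zipWith-identityˡ; zipWith-identityʳ; lookup-zipWith; lookup-replicate)
open import Function using (_∘_; Equivalence)
open import Relation.Binary.PropositionalEquality
open import Relation.Nullary using (¬_; contradiction)
open import Relation.Nullary.Decidable using (⌊_⌋; toWitness)

private
  variable
    m n : ℕ

-- Vectors over GF(2)

infixl 6 _⊕_

_⊕_ : Vec Bool m → Vec Bool m → Vec Bool m
_⊕_ = zipWith _xor_

𝟎 : Vec Bool m
𝟎 = replicate _ false

⊕-assoc : (u v w : Vec Bool m) → u ⊕ v ⊕ w ≡ u ⊕ (v ⊕ w)
⊕-assoc = zipWith-assoc xor-assoc

⊕-comm : (u v : Vec Bool m) → u ⊕ v ≡ v ⊕ u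
⊕-comm = zipWith-comm xor-comm

⊕-identityˡ : (u : Vec Bool m) → 𝟎 ⊕ u ≡ u
⊕-identityˡ = zipWith-identityˡ xor-identityˡ

⊕-identityʳ : (u : Vec Bool m) → u ⊕ 𝟎 ≡ u
⊕-identityʳ = zipWith-identityʳ xor-identityʳ

⊕-self : (u : Vec Bool m) → u ⊕ u ≡ 𝟎
⊕-self [] = refl
⊕-self (a ∷ u) = cong₂ _∷_ (xor-same a) (⊕-self u)

⊕-leftComm : (u v w : Vec Bool m) → u ⊕ (v ⊕ w) ≡ v ⊕ (u ⊕ w)
⊕-leftComm u v w = begin
  u ⊕ (v ⊕ w)  ≡⟨ ⊕-assoc u v w ⟨
  u ⊕ v ⊕ w    ≡⟨ cong (_⊕ w) (⊕-comm u v) ⟩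
  v ⊕ u ⊕ w    ≡⟨ ⊕-assoc v u w ⟩
  v ⊕ (u ⊕ w)  ∎
  where open ≡-Reasoning

⊕-cancel-shared : (c u v : Vec Bool m) → (c ⊕ u) ⊕ (c ⊕ v) ≡ u ⊕ v
⊕-cancel-shared c u v = begin
  c ⊕ u ⊕ (c ⊕ v)    ≡⟨ ⊕-assoc c u (c ⊕ v) ⟩
  c ⊕ (u ⊕ (c ⊕ v))  ≡⟨ cong (c ⊕_) (⊕-leftComm u c v) ⟩
  c ⊕ (c ⊕ (u ⊕ v))  ≡⟨ ⊕-assoc c c (u ⊕ v) ⟨
  c ⊕ c ⊕ (u ⊕ v)    ≡⟨ cong (_⊕ (u ⊕ v)) (⊕-self c) ⟩
  𝟎 ⊕ (u ⊕ v)        ≡⟨ ⊕-identityˡ (u ⊕ v) ⟩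
  u ⊕ v              ∎
  where open ≡-Reasoning

⊕≡𝟎⇒≡ : (u v : Vec Bool m) → u ⊕ v ≡ 𝟎 → u ≡ v
⊕≡𝟎⇒≡ u v u⊕v≡𝟎 = begin
  u            ≡⟨ ⊕-identityʳ u ⟨
  u ⊕ 𝟎        ≡⟨ cong (u ⊕_) (⊕-self v) ⟨
  u ⊕ (v ⊕ v)  ≡⟨ ⊕-assoc u v v ⟨
  u ⊕ v ⊕ v    ≡⟨ cong (_⊕ v) u⊕v≡𝟎 ⟩
  𝟎 ⊕ v        ≡⟨ ⊕-identityˡ v ⟩
  v            ∎
  where open ≡-Reasoning

lookup-⊕ : (u v : Vec Bool m) (i : Fin m) → lookup (u ⊕ v) i ≡ lookup u i xor lookup v i
lookup-⊕ u v i = lookup-zipWith _xor_ i u v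

lookup-𝟎 : (i : Fin m) → lookup (𝟎 {m}) i ≡ false
lookup-𝟎 i = lookup-replicate i false

lookup≡false⇒≡𝟎 : (u : Vec Bool m) → (∀ i → lookup u i ≡ false) → u ≡ 𝟎
lookup≡false⇒≡𝟎 [] _ = refl
lookup≡false⇒≡𝟎 (a ∷ u) u≡𝟎 = cong₂ _∷_ (u≡𝟎 zero) (lookup≡false⇒≡𝟎 u (u≡𝟎 ∘ suc))

lin : Vec (Vec Bool m) n → Vec Bool n → Vec Bool m
lin [] [] = 𝟎
lin (c ∷ cs) (false ∷ t) = lin cs t
lin (c ∷ cs) (true ∷ t) = c ⊕ lin cs t

lin-⊕ : (cs : Vec (Vec Bool m) n) (t u : Vec Bool n) → lin cs (t ⊕ u) ≡ lin cs t ⊕ lin cs u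
lin-⊕ [] [] [] = sym (⊕-identityˡ 𝟎)
lin-⊕ (c ∷ cs) (false ∷ t) (false ∷ u) = lin-⊕ cs t u
lin-⊕ (c ∷ cs) (false ∷ t) (true ∷ u) =
  trans (cong (c ⊕_) (lin-⊕ cs t u)) (⊕-leftComm c (lin cs t) (lin cs u))
lin-⊕ (c ∷ cs) (true ∷ t) (false ∷ u) =
  trans (cong (c ⊕_) (lin-⊕ cs t u)) (sym (⊕-assoc c (lin cs t) (lin cs u)))
lin-⊕ (c ∷ cs) (true ∷ t) (true ∷ u) =
  trans (lin-⊕ cs t u) (sym (⊕-cancel-shared c (lin cs t) (lin cs u)))

columns : Matrix m n → Vec (Vec Bool m) n
columns {n = zero} A = []
columns {n = suc n} A = Vec.map head A ∷ columns (Vec.map tail A)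

colSum-[] : (A : Matrix m 0) → colSum A [] ≡ 𝟎
colSum-[] [] = refl
colSum-[] ([] ∷ A) = cong (false ∷_) (colSum-[] A)

colSum-false : (A : Matrix m (suc n)) (t : Vec Bool n) →
  colSum A (false ∷ t) ≡ colSum (Vec.map tail A) t
colSum-false [] t = refl
colSum-false ((a ∷ row) ∷ A) t =
  cong₂ _∷_ (cong (_xor _) (∧-zeroʳ a)) (colSum-false A t)

colSum-true : (A : Matrix m (suc n)) (t : Vec Bool n) →
  colSum A (true ∷ t) ≡ Vec.map head A ⊕ colSum (Vec.map tail A) t
colSum-true [] t = refl
colSum-true ((a ∷ row) ∷ A) t =
  cong₂ _∷_ (cong (_xor _) (∧-identityʳ a)) (colSum-true A t)

colSum≡lin-columns : (A : Matrix m n) (t : Vec Bool n) → colSum A t ≡ lin (columns A) t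
colSum≡lin-columns {n = zero} A [] = colSum-[] A
colSum≡lin-columns {n = suc n} A (false ∷ t) =
  trans (colSum-false A t) (colSum≡lin-columns (Vec.map tail A) t)
colSum≡lin-columns {n = suc n} A (true ∷ t) =
  trans (colSum-true A t) (cong (Vec.map head A ⊕_) (colSum≡lin-columns (Vec.map tail A) t))

-- Echelon bases

-- Each basis vector is stored with its pivot; the most recently adjoined vector comes first.
Basis : ℕ → Set
Basis m = List (Fin m × Vec Bool m)

vectors : (B : Basis m) → Vec (Vec Bool m) (length B)
vectors [] = []
vectors ((_ , b) ∷ B) = b ∷ vectors B

linᴮ : (B : Basis m) → Vec Bool (length B) → Vec Bool m
linᴮ B = lin (vectors B)

VanishesAt : Basis m → Vec Bool m → Set
VanishesAt B w = All (λ pb → lookup w (proj₁ pb) ≡ false) B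

data Echelon {m : ℕ} : Basis m → Set where
  [] : Echelon []
  pivot : ∀ {p b B} → lookup b p ≡ true → VanishesAt B b → Echelon B → Echelon ((p , b) ∷ B)

eliminate : Fin m → Vec Bool m → Vec Bool m → Vec Bool m
eliminate p b u = if lookup u p then u ⊕ b else u

reduce : Vec Bool m → Basis m → Vec Bool m
reduce v [] = v
reduce v ((p , b) ∷ B) = eliminate p b (reduce v B)

coordinates : Vec Bool m → (B : Basis m) → Vec Bool (length B)
coordinates v [] = []
coordinates v ((p , b) ∷ B) = lookup (reduce v B) p ∷ coordinates v B

private
  variable
    B : Basis m

eliminate-on : ∀ {p : Fin m} {u} b → lookup u p ≡ true → eliminate p b u ≡ u ⊕ b
eliminate-on {u = u} b u[p] = cong (if_then u ⊕ b else u) u[p]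

eliminate-off : ∀ {p : Fin m} {u} b → lookup u p ≡ false → eliminate p b u ≡ u
eliminate-off {u = u} b u[p] = cong (if_then u ⊕ b else u) u[p]

lookup-⊕-false : ∀ (u v : Vec Bool m) {i a} → lookup u i ≡ a → lookup v i ≡ false → lookup (u ⊕ v) i ≡ a
lookup-⊕-false u v {i} {a} u[i] v[i] = trans (lookup-⊕ u v i) (trans (cong₂ _xor_ u[i] v[i]) (xor-identityʳ a))

VanishesAt-⊕ : ∀ u v → VanishesAt B u → VanishesAt B v → VanishesAt B (u ⊕ v)
VanishesAt-⊕ u v [] [] = []
VanishesAt-⊕ u v (u[p] ∷ zu) (v[p] ∷ zv) = lookup-⊕-false u v u[p] v[p] ∷ VanishesAt-⊕ u v zu zv

eliminate-⊕ : ∀ (p : Fin m) b u v → lookup v p ≡ false → eliminate p b (u ⊕ v) ≡ eliminate p b u ⊕ v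
eliminate-⊕ p b u v v[p] with lookup u p in u[p]
... | true = begin
  eliminate p b (u ⊕ v)  ≡⟨ eliminate-on b (lookup-⊕-false u v u[p] v[p]) ⟩
  u ⊕ v ⊕ b              ≡⟨ ⊕-assoc u v b ⟩
  u ⊕ (v ⊕ b)            ≡⟨ cong (u ⊕_) (⊕-comm v b) ⟩
  u ⊕ (b ⊕ v)            ≡⟨ ⊕-assoc u b v ⟨
  u ⊕ b ⊕ v              ∎
  where open ≡-Reasoning
... | false = eliminate-off b (lookup-⊕-false u v u[p] v[p])

reduce-⊕ : (B : Basis m) (u v : Vec Bool m) → VanishesAt B v → reduce (u ⊕ v) B ≡ reduce u B ⊕ v
reduce-⊕ [] u v [] = refl
reduce-⊕ ((p , b) ∷ B) u v (v[p] ∷ zv) =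
  trans (cong (eliminate p b) (reduce-⊕ B u v zv)) (eliminate-⊕ p b (reduce u B) v v[p])

reduce-𝟎 : (B : Basis m) → reduce 𝟎 B ≡ 𝟎
reduce-𝟎 [] = refl
reduce-𝟎 ((p , b) ∷ B) = trans (cong (eliminate p b) (reduce-𝟎 B)) (eliminate-off b (lookup-𝟎 p))

reduce-vanishes : Echelon B → (v : Vec Bool m) → VanishesAt B (reduce v B)
reduce-vanishes [] v = []
reduce-vanishes (pivot {p} {b} {B} b[p] zb e) v with lookup (reduce v B) p in r[p]
... | true = r⊕b[p] ∷ VanishesAt-⊕ (reduce v B) b (reduce-vanishes e v) zb
  where
  r⊕b[p] : lookup (reduce v B ⊕ b) p ≡ false
  r⊕b[p] = trans (lookup-⊕ (reduce v B) b p) (cong₂ _xor_ r[p] b[p])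
... | false = r[p] ∷ reduce-vanishes e v

reduce-linᴮ : Echelon B → (t : Vec Bool (length B)) → reduce (linᴮ B t) B ≡ 𝟎
reduce-⊕-linᴮ : Echelon B → ∀ {b} → VanishesAt B b → (t : Vec Bool (length B)) →
  reduce (b ⊕ linᴮ B t) B ≡ b

reduce-linᴮ [] [] = refl
reduce-linᴮ (pivot {p} {b} b[p] zb e) (false ∷ t) =
  trans (cong (eliminate p b) (reduce-linᴮ e t)) (eliminate-off b (lookup-𝟎 p))
reduce-linᴮ (pivot {p} {b} b[p] zb e) (true ∷ t) =
  trans (cong (eliminate p b) (reduce-⊕-linᴮ e zb t)) (trans (eliminate-on b b[p]) (⊕-self b))

reduce-⊕-linᴮ {B = B} e {b} zb t = begin
  reduce (b ⊕ linᴮ B t) B   ≡⟨ cong (λ v → reduce v B) (⊕-comm b (linᴮ B t)) ⟩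
  reduce (linᴮ B t ⊕ b) B   ≡⟨ reduce-⊕ B (linᴮ B t) b zb ⟩
  reduce (linᴮ B t) B ⊕ b   ≡⟨ cong (_⊕ b) (reduce-linᴮ e t) ⟩
  𝟎 ⊕ b                     ≡⟨ ⊕-identityˡ b ⟩
  b                         ∎
  where open ≡-Reasoning

linᴮ-injective : Echelon B → (t : Vec Bool (length B)) → linᴮ B t ≡ 𝟎 → t ≡ 𝟎
linᴮ-injective [] [] _ = refl
linᴮ-injective (pivot b[p] zb e) (false ∷ t) eq = cong (false ∷_) (linᴮ-injective e t eq)
linᴮ-injective (pivot {p} {b} {B} b[p] zb e) (true ∷ t) eq =
  contradiction (trans (sym b[p]) (trans (cong (λ v → lookup v p) b≡𝟎) (lookup-𝟎 p))) λ ()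
  where
  b≡𝟎 : b ≡ 𝟎
  b≡𝟎 = trans (sym (reduce-⊕-linᴮ e zb t)) (trans (cong (λ v → reduce v B) eq) (reduce-𝟎 B))

reduce-decomposition : (B : Basis m) (v : Vec Bool m) → v ≡ linᴮ B (coordinates v B) ⊕ reduce v B
reduce-decomposition [] v = sym (⊕-identityˡ v)
reduce-decomposition ((p , b) ∷ B) v with lookup (reduce v B) p
... | true = begin
  v                                                  ≡⟨ reduce-decomposition B v ⟩
  linᴮ B (coordinates v B) ⊕ reduce v B              ≡⟨ ⊕-cancel-shared b _ _ ⟨
  b ⊕ linᴮ B (coordinates v B) ⊕ (b ⊕ reduce v B)    ≡⟨ cong (b ⊕ linᴮ B (coordinates v B) ⊕_) (⊕-comm b (reduce v B)) ⟩
  b ⊕ linᴮ B (coordinates v B) ⊕ (reduce v B ⊕ b)    ∎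
  where open ≡-Reasoning
... | false = reduce-decomposition B v

linᴮ-⊕-column : (B : Basis m) (t : Vec Bool (length B)) (c w : Vec Bool m) →
  linᴮ B t ⊕ (c ⊕ w) ≡ reduce c B ⊕ linᴮ B (t ⊕ coordinates c B) ⊕ w
linᴮ-⊕-column B t c w = begin
  linᴮ B t ⊕ (c ⊕ w)                   ≡⟨ cong (λ c′ → linᴮ B t ⊕ (c′ ⊕ w)) (reduce-decomposition B c) ⟩
  linᴮ B t ⊕ (linᴮ B k ⊕ r ⊕ w)        ≡⟨ ⊕-assoc (linᴮ B t) (linᴮ B k ⊕ r) w ⟨
  linᴮ B t ⊕ (linᴮ B k ⊕ r) ⊕ w        ≡⟨ cong (_⊕ w) (⊕-assoc (linᴮ B t) (linᴮ B k) r) ⟨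
  linᴮ B t ⊕ linᴮ B k ⊕ r ⊕ w          ≡⟨ cong (_⊕ w) (⊕-comm (linᴮ B t ⊕ linᴮ B k) r) ⟩
  r ⊕ (linᴮ B t ⊕ linᴮ B k) ⊕ w        ≡⟨ cong (λ s → r ⊕ s ⊕ w) (lin-⊕ (vectors B) t k) ⟨
  r ⊕ linᴮ B (t ⊕ k) ⊕ w               ∎
  where
  open ≡-Reasoning
  k = coordinates c B
  r = reduce c B

leadingOne : Vec Bool m → Maybe (Fin m)
leadingOne [] = nothing
leadingOne (true ∷ v) = just zero
leadingOne (false ∷ v) = Maybe.map suc (leadingOne v)

adjoin : Basis m → Vec Bool m → Maybe (Basis m)
adjoin B r = Maybe.map (λ p → (p , r) ∷ B) (leadingOne r)

extend : Basis m → Vec Bool m → Maybe (Basis m)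
extend B c = adjoin B (reduce c B)

leadingOne-nothing : (v : Vec Bool m) → leadingOne v ≡ nothing → v ≡ 𝟎
leadingOne-nothing [] _ = refl
leadingOne-nothing (false ∷ v) eq with leadingOne v in e
... | nothing = cong (false ∷_) (leadingOne-nothing v e)

leadingOne-just : (v : Vec Bool m) {p : Fin m} → leadingOne v ≡ just p → lookup v p ≡ true
leadingOne-just (true ∷ v) refl = refl
leadingOne-just (false ∷ v) eq with leadingOne v in e
leadingOne-just (false ∷ v) refl | just q = leadingOne-just v e

leadingOne-𝟎 : leadingOne (𝟎 {m}) ≡ nothing
leadingOne-𝟎 {zero} = refl
leadingOne-𝟎 {suc m} = cong (Maybe.map suc) (leadingOne-𝟎 {m})

data ExtendView (B : Basis m) (c : Vec Bool m) : Maybe (Basis m) → Set where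
  in-span : reduce c B ≡ 𝟎 → ExtendView B c nothing
  new-pivot : ∀ p → lookup (reduce c B) p ≡ true → ExtendView B c (just ((p , reduce c B) ∷ B))

extend-view : (B : Basis m) (c : Vec Bool m) → ExtendView B c (extend B c)
extend-view B c with leadingOne (reduce c B) in e
... | nothing = in-span (leadingOne-nothing (reduce c B) e)
... | just p = new-pivot p (leadingOne-just (reduce c B) e)

Echelon-new-pivot : Echelon B → ∀ c p → lookup (reduce c B) p ≡ true → Echelon ((p , reduce c B) ∷ B)
Echelon-new-pivot e c p r[p] = pivot r[p] (reduce-vanishes e c) e

greedyBasis : Basis m → Vec (Vec Bool m) n → SubsetV n → Basis m
greedyBasis B [] [] = B
greedyBasis B (c ∷ cs) (false ∷ S) = greedyBasis B cs S
greedyBasis B (c ∷ cs) (true ∷ S) = greedyBasis (fromMaybe B (extend B c)) cs S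

greedySet : Basis m → Vec (Vec Bool m) n → SubsetV n → SubsetV n
greedySet B [] [] = []
greedySet B (c ∷ cs) (false ∷ S) = false ∷ greedySet B cs S
greedySet B (c ∷ cs) (true ∷ S) = is-just (extend B c) ∷ greedySet (fromMaybe B (extend B c)) cs S

dependence : Maybe (Basis m) → ℕ
dependence nothing = 1
dependence (just _) = 0

nullity : Basis m → Vec (Vec Bool m) n → SubsetV n → ℕ
nullity B [] [] = 0
nullity B (c ∷ cs) (false ∷ S) = nullity B cs S
nullity B (c ∷ cs) (true ∷ S) = dependence (extend B c) ℕ.+ nullity (fromMaybe B (extend B c)) cs S

_⊆_ : SubsetV n → SubsetV n → Set
X ⊆ Y = (X ⊆ᵇ Y) ≡ true

⊆-trans : (X Y Z : SubsetV n) → X ⊆ Y → Y ⊆ Z → X ⊆ Z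
⊆-trans [] [] [] _ _ = refl
⊆-trans (false ∷ X) (false ∷ Y) (z ∷ Z) X⊆Y Y⊆Z = ⊆-trans X Y Z X⊆Y Y⊆Z
⊆-trans (false ∷ X) (true ∷ Y) (true ∷ Z) X⊆Y Y⊆Z = ⊆-trans X Y Z X⊆Y Y⊆Z
⊆-trans (true ∷ X) (true ∷ Y) (true ∷ Z) X⊆Y Y⊆Z = ⊆-trans X Y Z X⊆Y Y⊆Z
⊆-trans (false ∷ X) (true ∷ Y) (false ∷ Z) X⊆Y ()
⊆-trans (true ∷ X) (true ∷ Y) (false ∷ Z) X⊆Y ()
⊆-trans (true ∷ X) (false ∷ Y) (z ∷ Z) () Y⊆Z

greedySet-⊆ : (B : Basis m) (cs : Vec (Vec Bool m) n) (S : SubsetV n) → greedySet B cs S ⊆ S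
greedySet-⊆ B [] [] = refl
greedySet-⊆ B (c ∷ cs) (false ∷ S) = greedySet-⊆ B cs S
greedySet-⊆ B (c ∷ cs) (true ∷ S) with extend B c
... | nothing = greedySet-⊆ B cs S
... | just B′ = greedySet-⊆ B′ cs S

size-greedySet : (B : Basis m) (cs : Vec (Vec Bool m) n) (S : SubsetV n) →
  size (greedySet B cs S) ℕ.+ length B ≡ length (greedyBasis B cs S)
size-greedySet B [] [] = refl
size-greedySet B (c ∷ cs) (false ∷ S) = size-greedySet B cs S
size-greedySet B (c ∷ cs) (true ∷ S) with extend B c | extend-view B c
... | _ | in-span _ = size-greedySet B cs S
... | _ | new-pivot p _ =
  trans (sym (ℕ.+-suc (size (greedySet _ cs S)) (length B))) (size-greedySet _ cs S)

size-nullity : (B : Basis m) (cs : Vec (Vec Bool m) n) (S : SubsetV n) →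
  size S ℕ.+ length B ≡ length (greedyBasis B cs S) ℕ.+ nullity B cs S
size-nullity B [] [] = sym (ℕ.+-identityʳ (length B))
size-nullity B (c ∷ cs) (false ∷ S) = size-nullity B cs S
size-nullity B (c ∷ cs) (true ∷ S) with extend B c | extend-view B c
... | _ | in-span _ = trans (cong suc (size-nullity B cs S)) (sym (ℕ.+-suc _ _))
... | _ | new-pivot p _ = trans (sym (ℕ.+-suc (size S) (length B))) (size-nullity _ cs S)

size∸rank≡nullity : (cs : Vec (Vec Bool m) n) (S : SubsetV n) →
  size S ∸ length (greedyBasis [] cs S) ≡ nullity [] cs S
size∸rank≡nullity cs S = begin
  size S ∸ r                  ≡⟨ cong (_∸ r) (ℕ.+-identityʳ (size S)) ⟨
  size S ℕ.+ 0 ∸ r            ≡⟨ cong (_∸ r) (size-nullity [] cs S) ⟩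
  r ℕ.+ nullity [] cs S ∸ r   ≡⟨ ℕ.m+n∸m≡n r (nullity [] cs S) ⟩
  nullity [] cs S             ∎
  where
  open ≡-Reasoning
  r = length (greedyBasis [] cs S)

greedySet-independent : Echelon B → (cs : Vec (Vec Bool m) n) (S T : SubsetV n) (t : Vec Bool (length B)) →
  T ⊆ greedySet B cs S → linᴮ B t ⊕ lin cs T ≡ 𝟎 → t ≡ 𝟎 × T ≡ 𝟎
greedySet-independent e [] [] [] t _ eq = linᴮ-injective e t (trans (sym (⊕-identityʳ _)) eq) , refl
greedySet-independent e (c ∷ cs) (false ∷ S) (false ∷ T) t T⊆ eq =
  map₂ (cong (false ∷_)) (greedySet-independent e cs S T t T⊆ eq)
greedySet-independent {B = B} e (c ∷ cs) (true ∷ S) (τ ∷ T) t T⊆ eq with extend B c | extend-view B c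
greedySet-independent e (c ∷ cs) (true ∷ S) (false ∷ T) t T⊆ eq | _ | in-span _ =
  map₂ (cong (false ∷_)) (greedySet-independent e cs S T t T⊆ eq)
greedySet-independent e (c ∷ cs) (true ∷ S) (false ∷ T) t T⊆ eq | _ | new-pivot p r[p]
  with greedySet-independent (Echelon-new-pivot e c p r[p]) cs S T (false ∷ t) T⊆ eq
... | t≡𝟎 , T≡𝟎 = cong tail t≡𝟎 , cong (false ∷_) T≡𝟎
greedySet-independent {B = B} e (c ∷ cs) (true ∷ S) (true ∷ T) t T⊆ eq | _ | new-pivot p r[p] =
  contradiction (cong head (proj₁ (greedySet-independent (Echelon-new-pivot e c p r[p]) cs S T
    (true ∷ (t ⊕ coordinates c B)) T⊆ (trans (sym (linᴮ-⊕-column B t c (lin cs T))) eq)))) λ ()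

greedyBasis-spans : (B : Basis m) (cs : Vec (Vec Bool m) n) (S X : SubsetV n) (t : Vec Bool (length B)) →
  X ⊆ S → ∃[ t′ ] (linᴮ B t ⊕ lin cs X ≡ linᴮ (greedyBasis B cs S) t′)
greedyBasis-spans B [] [] [] t _ = t , ⊕-identityʳ _
greedyBasis-spans B (c ∷ cs) (false ∷ S) (false ∷ X) t X⊆S = greedyBasis-spans B cs S X t X⊆S
greedyBasis-spans B (c ∷ cs) (true ∷ S) X t X⊆S with extend B c | extend-view B c
greedyBasis-spans B (c ∷ cs) (true ∷ S) (false ∷ X) t X⊆S | _ | in-span _ =
  greedyBasis-spans B cs S X t X⊆S
greedyBasis-spans B (c ∷ cs) (true ∷ S) (false ∷ X) t X⊆S | _ | new-pivot p _ =
  greedyBasis-spans _ cs S X (false ∷ t) X⊆S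
greedyBasis-spans B (c ∷ cs) (true ∷ S) (true ∷ X) t X⊆S | _ | in-span r≡𝟎 =
  map₂ (trans (trans (linᴮ-⊕-column B t c (lin cs X))
                     (trans (cong (λ r → r ⊕ linᴮ B (t ⊕ coordinates c B) ⊕ lin cs X) r≡𝟎)
                            (cong (_⊕ lin cs X) (⊕-identityˡ (linᴮ B (t ⊕ coordinates c B)))))))
       (greedyBasis-spans B cs S X (t ⊕ coordinates c B) X⊆S)
greedyBasis-spans B (c ∷ cs) (true ∷ S) (true ∷ X) t X⊆S | _ | new-pivot p _ =
  map₂ (trans (linᴮ-⊕-column B t c (lin cs X)))
       (greedyBasis-spans _ cs S X (true ∷ (t ⊕ coordinates c B)) X⊆S)

bitToFin : Bool → Fin 2
bitToFin false = zero
bitToFin true = suc zero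

finToBit : Fin 2 → Bool
finToBit zero = false
finToBit (suc zero) = true

encode : Vec Bool n → Fin (2 ℕ.^ n)
encode [] = zero
encode (b ∷ v) = combine (bitToFin b) (encode v)

decode : ∀ n → Fin (2 ℕ.^ n) → Vec Bool n
decode zero _ = []
decode (suc n) i = finToBit (proj₁ (remQuot {2} (2 ℕ.^ n) i)) ∷ decode n (proj₂ (remQuot {2} (2 ℕ.^ n) i))

decode-encode : (v : Vec Bool n) → decode n (encode v) ≡ v
decode-encode [] = refl
decode-encode {suc n} (b ∷ v) = cong₂ _∷_
  (trans (cong (finToBit ∘ proj₁) remQuot-encode) (finToBit-bitToFin b))
  (trans (cong (decode n ∘ proj₂) remQuot-encode) (decode-encode v))
  where
  remQuot-encode = remQuot-combine {2} {2 ℕ.^ n} (bitToFin b) (encode v)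
  finToBit-bitToFin : ∀ b → finToBit (bitToFin b) ≡ b
  finToBit-bitToFin false = refl
  finToBit-bitToFin true = refl

encode-decode : ∀ n (i : Fin (2 ℕ.^ n)) → encode (decode n i) ≡ i
encode-decode zero zero = refl
encode-decode (suc n) i =
  trans (cong₂ combine (bitToFin-finToBit (proj₁ q)) (encode-decode n (proj₂ q))) (combine-remQuot {2} (2 ℕ.^ n) i)
  where
  q = remQuot {2} (2 ℕ.^ n) i
  bitToFin-finToBit : ∀ b → bitToFin (finToBit b) ≡ b
  bitToFin-finToBit zero = refl
  bitToFin-finToBit (suc zero) = refl

encode-injective : (u v : Vec Bool n) → encode u ≡ encode v → u ≡ v
encode-injective {n} u v eq = trans (sym (decode-encode u)) (trans (cong (decode n) eq) (decode-encode v))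

injection⇒≤ : ∀ {k r} (f : Vec Bool k → Vec Bool r) → (∀ u v → f u ≡ f v → u ≡ v) → k ≤ r
injection⇒≤ {k} {r} f f-inj = ℕ.≮⇒≥ λ r<k → ℕ.<⇒≱ (ℕ.^-monoʳ-< 2 (s≤s (s≤s z≤n)) r<k) 2^k≤2^r
  where
  2^k≤2^r : 2 ℕ.^ k ≤ 2 ℕ.^ r
  2^k≤2^r = injective⇒≤ {f = encode ∘ f ∘ decode k} λ {i} {j} eq → begin
    i                    ≡⟨ encode-decode k i ⟨
    encode (decode k i)  ≡⟨ cong encode (f-inj _ _ (encode-injective _ _ eq)) ⟩
    encode (decode k j)  ≡⟨ encode-decode k j ⟩
    j                    ∎
    where open ≡-Reasoning

-- Rank

Independent : Vec (Vec Bool m) n → SubsetV n → Set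
Independent cs J = ∀ T → T ⊆ J → lin cs T ≡ 𝟎 → T ≡ 𝟎

expand : (J : SubsetV n) → Vec Bool (size J) → SubsetV n
expand [] [] = []
expand (true ∷ J) (b ∷ u) = b ∷ expand J u
expand (false ∷ J) u = false ∷ expand J u

expand-⊆ : (J : SubsetV n) (u : Vec Bool (size J)) → expand J u ⊆ J
expand-⊆ [] [] = refl
expand-⊆ (true ∷ J) (true ∷ u) = expand-⊆ J u
expand-⊆ (true ∷ J) (false ∷ u) = expand-⊆ J u
expand-⊆ (false ∷ J) u = expand-⊆ J u

expand-⊕ : (J : SubsetV n) (u v : Vec Bool (size J)) → expand J u ⊕ expand J v ≡ expand J (u ⊕ v)
expand-⊕ [] [] [] = refl
expand-⊕ (true ∷ J) (a ∷ u) (b ∷ v) = cong ((a xor b) ∷_) (expand-⊕ J u v)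
expand-⊕ (false ∷ J) u v = cong (false ∷_) (expand-⊕ J u v)

expand≡𝟎 : (J : SubsetV n) (u : Vec Bool (size J)) → expand J u ≡ 𝟎 → u ≡ 𝟎
expand≡𝟎 [] [] _ = refl
expand≡𝟎 (true ∷ J) (a ∷ u) eq = cong₂ _∷_ (cong head eq) (expand≡𝟎 J u (cong tail eq))
expand≡𝟎 (false ∷ J) u eq = expand≡𝟎 J u (cong tail eq)

-- u ↦ coordinates of lin cs (expand J u) in the greedy basis is injective when J is independent.
Independent-size≤ : (cs : Vec (Vec Bool m) n) (S J : SubsetV n) →
  Independent cs J → J ⊆ S → size J ≤ length (greedyBasis [] cs S)
Independent-size≤ cs S J J-indep J⊆S = injection⇒≤ coords coords-injective
  where
  span : ∀ u → ∃[ t ] (linᴮ [] [] ⊕ lin cs (expand J u) ≡ linᴮ (greedyBasis [] cs S) t)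
  span u = greedyBasis-spans [] cs S (expand J u) [] (⊆-trans (expand J u) J S (expand-⊆ J u) J⊆S)
  coords : Vec Bool (size J) → Vec Bool (length (greedyBasis [] cs S))
  coords u = proj₁ (span u)
  lin-expand : ∀ u → lin cs (expand J u) ≡ linᴮ (greedyBasis [] cs S) (coords u)
  lin-expand u = trans (sym (⊕-identityˡ _)) (proj₂ (span u))
  coords-injective : ∀ u v → coords u ≡ coords v → u ≡ v
  coords-injective u v eq = ⊕≡𝟎⇒≡ u v (expand≡𝟎 J (u ⊕ v)
    (J-indep (expand J (u ⊕ v)) (expand-⊆ J (u ⊕ v)) (begin
      lin cs (expand J (u ⊕ v))                        ≡⟨ cong (lin cs) (expand-⊕ J u v) ⟨
      lin cs (expand J u ⊕ expand J v)                 ≡⟨ lin-⊕ cs (expand J u) (expand J v) ⟩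
      lin cs (expand J u) ⊕ lin cs (expand J v)        ≡⟨ cong (_⊕ _) (trans (lin-expand u)
                                                             (trans (cong (linᴮ (greedyBasis [] cs S)) eq) (sym (lin-expand v)))) ⟩
      lin cs (expand J v) ⊕ lin cs (expand J v)        ≡⟨ ⊕-self _ ⟩
      𝟎                                                ∎)))
    where open ≡-Reasoning

isEmpty⇒≡𝟎 : (T : SubsetV n) → isEmpty T ≡ true → T ≡ 𝟎
isEmpty⇒≡𝟎 [] _ = refl
isEmpty⇒≡𝟎 (false ∷ T) e = cong (false ∷_) (isEmpty⇒≡𝟎 T e)

isEmpty-𝟎 : isEmpty (𝟎 {n}) ≡ true
isEmpty-𝟎 {zero} = refl
isEmpty-𝟎 {suc n} = isEmpty-𝟎 {n}

∈-allSubsets : (S : SubsetV n) → S ∈ allSubsets n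
∈-allSubsets [] = here refl
∈-allSubsets {suc n} (false ∷ S) = ++⁺ˡ (map⁺ (Any.map (cong (false ∷_)) (∈-allSubsets S)))
∈-allSubsets {suc n} (true ∷ S) =
  ++⁺ʳ (List.map (false ∷_) (allSubsets n)) (map⁺ (Any.map (cong (true ∷_)) (∈-allSubsets S)))

all-elim : ∀ {A : Set} (p : A → Bool) {xs x} → all p xs ≡ true → x ∈ xs → p x ≡ true
all-elim p {y ∷ ys} all≡true (here refl) with p y
... | true = refl
all-elim p {y ∷ ys} all≡true (there x∈ys) with p y
... | true = all-elim p all≡true x∈ys

all-intro : ∀ {A : Set} (p : A → Bool) (xs : List A) → (∀ x → p x ≡ true) → all p xs ≡ true
all-intro p [] _ = refl
all-intro p (y ∷ ys) p≡true rewrite p≡true y = all-intro p ys p≡true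

-- The Boolean shape of the test in `independent`: a → (z → e).
not-∧-not-∧-elim : ∀ a e z → not (a ∧ not e ∧ z) ≡ true → a ≡ true → z ≡ true → e ≡ true
not-∧-not-∧-elim .true true .true _ refl refl = refl

not-∧-not-∧-intro : ∀ a e z → (a ≡ true → z ≡ true → e ≡ true) → not (a ∧ not e ∧ z) ≡ true
not-∧-not-∧-intro false e z _ = refl
not-∧-not-∧-intro true true z _ = refl
not-∧-not-∧-intro true false false _ = refl
not-∧-not-∧-intro true false true a→z→e with () ← a→z→e refl refl

independent⇒Independent : (A : Matrix m n) (I : SubsetV n) → independent A I ≡ true → Independent (columns A) I
independent⇒Independent {m} {n} A I indep T T⊆I lin≡𝟎 =
  isEmpty⇒≡𝟎 T (not-∧-not-∧-elim (T ⊆ᵇ I) (isEmpty T) (isZeroVec (colSum A T))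
    (all-elim _ indep (∈-allSubsets T)) T⊆I
    (trans (cong isZeroVec (trans (colSum≡lin-columns A T) lin≡𝟎)) (isEmpty-𝟎 {m})))

Independent⇒independent : (A : Matrix m n) (I : SubsetV n) → Independent (columns A) I → independent A I ≡ true
Independent⇒independent {n = n} A I indep = all-intro _ (allSubsets n) λ T →
  not-∧-not-∧-intro (T ⊆ᵇ I) (isEmpty T) (isZeroVec (colSum A T)) λ T⊆I colSum≡𝟎 →
    subst (λ U → isEmpty U ≡ true)
      (sym (indep T T⊆I (trans (sym (colSum≡lin-columns A T)) (isEmpty⇒≡𝟎 _ colSum≡𝟎))))
      (isEmpty-𝟎 {n})

maximum-filter-lub : (p : SubsetV n → Bool) (xs : List (SubsetV n)) (g : ℕ) →
  (∀ I → p I ≡ true → size I ≤ g) → List.foldr _⊔_ 0 (List.map size (List.filterᵇ p xs)) ≤ g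
maximum-filter-lub p [] g bound = z≤n
maximum-filter-lub p (x ∷ xs) g bound with p x in px
... | true = ℕ.⊔-lub (bound x px) (maximum-filter-lub p xs g bound)
... | false = maximum-filter-lub p xs g bound

≤-maximum-filter : (p : SubsetV n → Bool) {xs : List (SubsetV n)} {x : SubsetV n} →
  x ∈ xs → p x ≡ true → size x ≤ List.foldr _⊔_ 0 (List.map size (List.filterᵇ p xs))
≤-maximum-filter p (here refl) px rewrite px = ℕ.m≤m⊔n _ _
≤-maximum-filter p {y ∷ ys} (there x∈ys) px with p y
... | true = ℕ.≤-trans (≤-maximum-filter p x∈ys px) (ℕ.m≤n⊔m (size y) _)
... | false = ≤-maximum-filter p x∈ys px

rank≡greedy : (A : Matrix m n) (S : SubsetV n) → rank A S ≡ length (greedyBasis [] (columns A) S)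
rank≡greedy {n = n} A S = ℕ.≤-antisym
  (maximum-filter-lub indepSubset (allSubsets n) _ λ I e →
    Independent-size≤ (columns A) S I (independent⇒Independent A I (∧-conicalʳ _ _ e)) (∧-conicalˡ _ _ e))
  (subst (_≤ rank A S) (trans (sym (ℕ.+-identityʳ _)) (size-greedySet [] (columns A) S))
    (≤-maximum-filter indepSubset (∈-allSubsets I₀) I₀-indepSubset))
  where
  indepSubset : SubsetV n → Bool
  indepSubset I = (I ⊆ᵇ S) ∧ independent A I
  I₀ = greedySet [] (columns A) S
  I₀-indepSubset : indepSubset I₀ ≡ true
  I₀-indepSubset rewrite greedySet-⊆ [] (columns A) S =
    Independent⇒independent A I₀ λ T T⊆I₀ lin≡𝟎 →
      proj₂ (greedySet-independent [] (columns A) S T [] T⊆I₀ (trans (⊕-identityˡ _) lin≡𝟎))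

-- The Tutte sum

sumᶻ : List ℤ → ℤ
sumᶻ = List.foldr _+_ (+ 0)

sumᶻ-++ : (xs ys : List ℤ) → sumᶻ (xs ++ ys) ≡ sumᶻ xs + sumᶻ ys
sumᶻ-++ [] ys = sym (ℤ.+-identityˡ (sumᶻ ys))
sumᶻ-++ (x ∷ xs) ys = trans (cong (λ s → x + s) (sumᶻ-++ xs ys)) (sym (ℤ.+-assoc x (sumᶻ xs) (sumᶻ ys)))

sum-allSubsets-suc : (f : SubsetV (suc n) → ℤ) →
  sumᶻ (List.map f (allSubsets (suc n)))
    ≡ sumᶻ (List.map (f ∘ (false ∷_)) (allSubsets n)) + sumᶻ (List.map (f ∘ (true ∷_)) (allSubsets n))
sum-allSubsets-suc {n} f = begin
  sumᶻ (List.map f (List.map (false ∷_) xs ++ List.map (true ∷_) xs))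
    ≡⟨ cong sumᶻ (map-++ f (List.map (false ∷_) xs) _) ⟩
  sumᶻ (List.map f (List.map (false ∷_) xs) ++ List.map f (List.map (true ∷_) xs))
    ≡⟨ sumᶻ-++ (List.map f (List.map (false ∷_) xs)) _ ⟩
  sumᶻ (List.map f (List.map (false ∷_) xs)) + sumᶻ (List.map f (List.map (true ∷_) xs))
    ≡⟨ cong₂ _+_ (cong sumᶻ (map-∘ xs)) (cong sumᶻ (map-∘ xs)) ⟨
  sumᶻ (List.map (f ∘ (false ∷_)) xs) + sumᶻ (List.map (f ∘ (true ∷_)) xs) ∎
  where
  open ≡-Reasoning
  xs = allSubsets n

sum-powers : ∀ n (Y : ℤ) ν → sumᶻ (List.map (λ S → Y ^ (ν ℕ.+ size S)) (allSubsets n)) ≡ Y ^ ν * (1ℤ + Y) ^ n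
sum-powers zero Y ν =
  trans (ℤ.+-identityʳ _) (trans (cong (Y ^_) (ℕ.+-identityʳ ν)) (sym (ℤ.*-identityʳ _)))
sum-powers (suc n) Y ν = begin
  sumᶻ (List.map (λ S → Y ^ (ν ℕ.+ size S)) (allSubsets (suc n)))
    ≡⟨ sum-allSubsets-suc {n} (λ S → Y ^ (ν ℕ.+ size S)) ⟩
  sumᶻ (List.map (λ S → Y ^ (ν ℕ.+ size S)) xs) + sumᶻ (List.map (λ S → Y ^ (ν ℕ.+ suc (size S))) xs)
    ≡⟨ cong (λ s → sumᶻ (List.map (λ S → Y ^ (ν ℕ.+ size S)) xs) + s) (cong sumᶻ (map-cong (λ S → cong (Y ^_) (ℕ.+-suc ν (size S))) xs)) ⟩
  sumᶻ (List.map (λ S → Y ^ (ν ℕ.+ size S)) xs) + sumᶻ (List.map (λ S → Y ^ (suc ν ℕ.+ size S)) xs)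
    ≡⟨ cong₂ _+_ (sum-powers n Y ν) (sum-powers n Y (suc ν)) ⟩
  Y ^ ν * (1ℤ + Y) ^ n + Y * Y ^ ν * (1ℤ + Y) ^ n
    ≡⟨ factor (Y ^ ν) ((1ℤ + Y) ^ n) Y ⟩
  Y ^ ν * ((1ℤ + Y) * (1ℤ + Y) ^ n) ∎
  where
  open ≡-Reasoning
  open +-*-Solver
  xs = allSubsets n
  factor : ∀ a p y → a * p + y * a * p ≡ a * ((1ℤ + y) * p)
  factor = solve 3 (λ a p y → a :* p :+ y :* a :* p := a :* ((con 1ℤ :+ y) :* p)) refl

isFull : Basis m → Bool
isFull {m} B = (length B ≡ᵇ m) ∧ ⌊ all? (λ i → any? ((i Fin.≟_) ∘ proj₁) B) ⌋

isFull⇒length≡ : {B : Basis m} → T (isFull B) → length B ≡ m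
isFull⇒length≡ {B = B} full = ℕ.≡ᵇ⇒≡ (length B) _ (proj₁ (Equivalence.to T-∧ full))

isFull⇒in-span : {m : ℕ} {B : Basis m} → T (isFull B) → Echelon B → (c : Vec Bool m) → extend B c ≡ nothing
isFull⇒in-span {m} {B} full e c =
  trans (cong (adjoin B) (lookup≡false⇒≡𝟎 (reduce c B) λ i →
          All.lookupWith {R = λ _ → lookup (reduce c B) i ≡ false}
            (λ r[p] i≡p → subst (λ j → lookup (reduce c B) j ≡ false) (sym i≡p) r[p])
            (reduce-vanishes e c) (every-pivot i)))
        (cong (Maybe.map (λ p → (p , 𝟎) ∷ B)) (leadingOne-𝟎 {m}))
  where
  every-pivot : ∀ i → Any ((i ≡_) ∘ proj₁) B
  every-pivot = toWitness {a? = all? (λ i → any? ((i Fin.≟_) ∘ proj₁) B)} (proj₂ (Equivalence.to T-∧ full))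

in-span⇒greedy-stable : (∀ c → extend B c ≡ nothing) → (cs : Vec (Vec Bool m) n) (S : SubsetV n) →
  greedyBasis B cs S ≡ B × nullity B cs S ≡ size S
in-span⇒greedy-stable stuck [] [] = refl , refl
in-span⇒greedy-stable stuck (c ∷ cs) (false ∷ S) = in-span⇒greedy-stable stuck cs S
in-span⇒greedy-stable stuck (c ∷ cs) (true ∷ S) rewrite stuck c =
  map₂ (cong suc) (in-span⇒greedy-stable stuck cs S)

-- Once the basis is full every remaining column is dependent, so the sum over the remaining
-- subsets collapses to Y^ν (1 + Y)^n without further recursion.
rankGen : ℤ → ℤ → Basis m → ℕ → Vec (Vec Bool m) n → ℤ
rankGenStep : ℤ → ℤ → Basis m → ℕ → Vec (Vec Bool m) n → Maybe (Basis m) → ℤ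

rankGen {m} X Y B ν [] = X ^ (m ∸ length B) * Y ^ ν
rankGen X Y B ν (c ∷ cs) = rankGen X Y B ν cs + rankGenStep X Y B ν cs (extend B c)

rankGenStep X Y B ν cs nothing = rankGen X Y B (suc ν) cs
rankGenStep {n = n} X Y B ν cs (just B′) = if isFull B′ then Y ^ ν * (1ℤ + Y) ^ n else rankGen X Y B′ ν cs

rankTerm : ℤ → ℤ → Basis m → ℕ → Vec (Vec Bool m) n → SubsetV n → ℤ
rankTerm {m} X Y B ν cs S = X ^ (m ∸ length (greedyBasis B cs S)) * Y ^ (ν ℕ.+ nullity B cs S)

rankGen-sum : (X Y : ℤ) (B : Basis m) (ν : ℕ) (cs : Vec (Vec Bool m) n) → Echelon B →
  sumᶻ (List.map (rankTerm X Y B ν cs) (allSubsets n)) ≡ rankGen X Y B ν cs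
rankGen-sum {m} X Y B ν [] e =
  trans (ℤ.+-identityʳ _) (cong (λ k → X ^ (m ∸ length B) * Y ^ k) (ℕ.+-identityʳ ν))
rankGen-sum {m} {suc n} X Y B ν (c ∷ cs) e =
  trans (sum-allSubsets-suc (rankTerm X Y B ν (c ∷ cs)))
        (cong₂ _+_ (rankGen-sum X Y B ν cs e) (selected (extend-view B c)))
  where
  xs = allSubsets n
  term : Maybe (Basis m) → SubsetV n → ℤ
  term mb S = X ^ (m ∸ length (greedyBasis (fromMaybe B mb) cs S))
              * Y ^ (ν ℕ.+ (dependence mb ℕ.+ nullity (fromMaybe B mb) cs S))
  selected : ∀ {mb} → ExtendView B c mb → sumᶻ (List.map (term mb) xs) ≡ rankGenStep X Y B ν cs mb
  selected (in-span _) =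
    trans (cong sumᶻ (map-cong (λ S → cong (λ k → X ^ (m ∸ length (greedyBasis B cs S)) * Y ^ k)
                                            (ℕ.+-suc ν (nullity B cs S))) xs))
          (rankGen-sum X Y B (suc ν) cs e)
  selected (new-pivot p r[p]) with isFull ((p , reduce c B) ∷ B) in full
  ... | false = rankGen-sum X Y _ ν cs (Echelon-new-pivot e c p r[p])
  ... | true = trans (cong sumᶻ (map-cong collapse xs)) (sum-powers n Y ν)
    where
    B′ = (p , reduce c B) ∷ B
    T-full : T (isFull B′)
    T-full = subst T (sym full) tt
    stable = in-span⇒greedy-stable (isFull⇒in-span T-full (Echelon-new-pivot e c p r[p])) cs
    collapse : ∀ S → term (just B′) S ≡ Y ^ (ν ℕ.+ size S)
    collapse S = begin
      X ^ (m ∸ length (greedyBasis B′ cs S)) * Y ^ (ν ℕ.+ nullity B′ cs S)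
        ≡⟨ cong₂ (λ B″ k → X ^ (m ∸ length B″) * Y ^ (ν ℕ.+ k)) (proj₁ (stable S)) (proj₂ (stable S)) ⟩
      X ^ (m ∸ length B′) * Y ^ (ν ℕ.+ size S)
        ≡⟨ cong (λ l → X ^ (m ∸ l) * Y ^ (ν ℕ.+ size S)) (isFull⇒length≡ {B = B′} T-full) ⟩
      X ^ (m ∸ m) * Y ^ (ν ℕ.+ size S)
        ≡⟨ cong (λ k → X ^ k * Y ^ (ν ℕ.+ size S)) (ℕ.n∸n≡0 m) ⟩
      1ℤ * Y ^ (ν ℕ.+ size S)
        ≡⟨ ℤ.*-identityˡ _ ⟩
      Y ^ (ν ℕ.+ size S) ∎
      where open ≡-Reasoning

tutte≡rankGen : (A : Matrix m n) (x y : ℤ) → rank A (fullSet n) ≡ m →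
  tutte A x y ≡ rankGen (x - + 1) (y - + 1) [] 0 (columns A)
tutte≡rankGen {m} {n} A x y rankE≡m =
  trans (cong sumᶻ (map-cong term (allSubsets n))) (rankGen-sum (x - + 1) (y - + 1) [] 0 (columns A) [])
  where
  term : ∀ S → (x - + 1) ^ (rank A (fullSet n) ∸ rank A S) * (y - + 1) ^ (size S ∸ rank A S)
             ≡ rankTerm (x - + 1) (y - + 1) [] 0 (columns A) S
  term S = trans
    (cong₂ (λ r s → (x - + 1) ^ (r ∸ s) * (y - + 1) ^ (size S ∸ s)) rankE≡m (rank≡greedy A S))
    (cong (λ k → (x - + 1) ^ (m ∸ length (greedyBasis [] (columns A) S)) * (y - + 1) ^ k)
          (size∸rank≡nullity (columns A) S))

-- The matroid N

tutte-N : ∀ x y → tutte matN x y ≡ rankGen (x - + 1) (y - + 1) [] 0 (columns matN)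
tutte-N x y = tutte≡rankGen matN x y (trans (rank≡greedy matN (fullSet 18)) refl)

tutte-N-−1 : tutte matN (- (+ 1)) (- (+ 1)) ≡ + 64
tutte-N-−1 = trans (tutte-N (- (+ 1)) (- (+ 1))) refl

tutte-N-−9 : tutte matN (shift (- (+ 2))) (shift (- (+ 2))) ≡ (+ 2 * + 1172750427) * + 64
tutte-N-−9 = trans (tutte-N (shift (- (+ 2))) (shift (- (+ 2)))) refl

tutte-N-−5 : tutte matN (shift (- (+ 1))) (shift (- (+ 1))) ≡ (+ 2 * + 642555) * + 64
tutte-N-−5 = trans (tutte-N (shift (- (+ 1))) (shift (- (+ 1)))) refl

tutte-N-7 : tutte matN (shift (+ 2)) (shift (+ 2)) ≡ (+ 2 * + 272762028) * + 64
tutte-N-7 = trans (tutte-N (shift (+ 2)) (shift (+ 2))) refl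

-- The implicit arguments of cong are given so that unification never unfolds tutte matN.
scale-tutte-N-−1 : ∀ a → a * + 64 ≡ a * tutte matN (- (+ 1)) (- (+ 1))
scale-tutte-N-−1 a = cong (a *_) {+ 64} {tutte matN (- (+ 1)) (- (+ 1))} (sym tutte-N-−1)

odd≢even : ∀ k j → + 2 * k + + 1 ≢ + 2 * j
odd≢even k j eq = ℕ.even≢odd ∣ j - k ∣ 0 (sym (trans (cong ∣_∣ 1≡2[j-k]) (ℤ.abs-* (+ 2) (j - k))))
  where
  open +-*-Solver
  1≡2[j-k] : + 1 ≡ + 2 * (j - k)
  1≡2[j-k] = begin
    + 1                        ≡⟨ solve 1 (λ k → con (+ 1) := con (+ 2) :* k :+ con (+ 1) :- con (+ 2) :* k) refl k ⟩
    + 2 * k + + 1 - + 2 * k    ≡⟨ cong (_- + 2 * k) eq ⟩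
    + 2 * j - + 2 * k          ≡⟨ solve 2 (λ j k → con (+ 2) :* j :- con (+ 2) :* k := con (+ 2) :* (j :- k)) refl j k ⟩
    + 2 * (j - k)              ∎
    where open ≡-Reasoning

mainTheorem1 :
    (tutte matN (- (+ 1)) (- (+ 1)) ≡ (+ 2) ^ 6)
    × (∀ (z : ℤ) → (z ≡ - (+ 2)) ⊎ (z ≡ - (+ 1)) ⊎ (z ≡ + 2) →
         ∃[ k ] (tutte matN (shift z) (shift z) ≡ ((+ 2) * k) * tutte matN (- (+ 1)) (- (+ 1))))
    × ¬ (∀ (m n : ℕ) (B : Matrix m n) (z : ℤ) →
         ∃[ k ] (tutte B (shift z) (shift z) ≡ ((+ 2) * k + (+ 1)) * tutte B (- (+ 1)) (- (+ 1))))
mainTheorem1 = tutte-N-−1 , even-ratio , λ always-odd → odd-ratio-fails (always-odd 6 18 matN (- (+ 1)))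
  where
  EvenRatio : ℤ → Set
  EvenRatio z = ∃[ k ] (tutte matN (shift z) (shift z) ≡ (+ 2 * k) * tutte matN (- (+ 1)) (- (+ 1)))
  even-ratio-of : ∀ z k → tutte matN (shift z) (shift z) ≡ (+ 2 * k) * + 64 → EvenRatio z
  even-ratio-of z k eq = k , trans eq (scale-tutte-N-−1 (+ 2 * k))
  even-ratio : ∀ z → (z ≡ - (+ 2)) ⊎ (z ≡ - (+ 1)) ⊎ (z ≡ + 2) → EvenRatio z
  even-ratio _ (inj₁ refl) = even-ratio-of (- (+ 2)) (+ 1172750427) tutte-N-−9
  even-ratio _ (inj₂ (inj₁ refl)) = even-ratio-of (- (+ 1)) (+ 642555) tutte-N-−5
  even-ratio _ (inj₂ (inj₂ refl)) = even-ratio-of (+ 2) (+ 272762028) tutte-N-7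
  odd-ratio-fails : ¬ (∃[ k ] (tutte matN (shift (- (+ 1))) (shift (- (+ 1)))
                                ≡ (+ 2 * k + + 1) * tutte matN (- (+ 1)) (- (+ 1))))
  odd-ratio-fails (k , eq) = odd≢even k (+ 642555) (ℤ.*-cancelʳ-≡ (+ 2 * k + + 1) (+ 2 * + 642555) (+ 64)
    (trans (scale-tutte-N-−1 (+ 2 * k + + 1)) (trans (sym eq) tutte-N-−5)))
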